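{- Let $k\ge2$ be an integer and $\lambda$ a partition. Then there is a polynomial $Q_{k,\lambda}\in\mathbb{Z}[\alpha]$ such that $\sqrt{\alpha}^{\,k-2}M^{(\alpha)}_k(\lambda)=Q_{k,\lambda}(\alpha)$ for all $\alpha>0$.
   Context: Young diagrams (French convention): for a partition $\lambda=(\lambda_1\ge\dots\ge\lambda_\ell>0)$, box $(i,j)$, $1\le i\le\ell$, $1\le j\le\lambda_i$, is the unit square $[j-1,j]\times[i-1,i]$; the boundary of $\lambda$ is the staircase line from $(0,\ell)$ to $(\lambda_1,0)$ made of horizontal segments traversed left to right and vertical segments traversed top to bottom. For $s,t>0$, $T_{s,t}(\lambda)$ is the image of this line under $(x,y)\mapsto(sx,ty)$. For such a line $L$, the content of a point $(x,y)$ is $x-y$; $\mathbb I_L$ is the set of contents of the points where $L$ turns from moving right to moving down, and $\mathbb O_L$ is the set of contents of the points where $L$ turns from moving down to moving right, together with the two endpoints of $L$. For $\alpha>0$, with $L=T_{\sqrt\alpha,1/\sqrt\alpha}(\lambda)$, the anisotropic moments $M^{(\alpha)}_k(\lambda)$, $k\ge0$, are defined by $\sum_{k\ge0}M^{(\alpha)}_k(\lambda)z^k=\prod_{i\in\mathbb I_L}(1-iz)/\prod_{o\in\mathbb O_L}(1-oz)$ (equivalently, the moments of the probability measure whose Cauchy transform is $\prod_{i\in\mathbb I_L}(z-i)/\prod_{o\in\mathbb O_L}(z-o)$). -}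

module Defs where

open import Level using (0ℓ)
open import Data.Nat using (ℕ; zero; suc; _∸_; _<_; _≥_)
open import Data.Integer using (ℤ; +_; -[1+_])
open import Data.List using (List; []; _∷_; _++_; replicate; length)
open import Data.List.Relation.Unary.All using (All)
open import Data.List.Relation.Unary.Linked using (Linked)
open import Data.Product using (_×_; _,_)
open import Algebra.Bundles using (CommutativeRing)

IsPartition : List ℕ → Set
IsPartition μ = Linked _≥_ μ × All (0 <_) μ

data Step : Set where
  R D : Step

head0 : List ℕ → ℕ
head0 []      = 0
head0 (a ∷ _) = a

-- Steps of the boundary line of λ = (λ₁,…,λ_ℓ) from (0,ℓ) to (λ₁,0):
-- R^{λ_ℓ} D R^{λ_{ℓ-1}-λ_ℓ} D … R^{λ₁-λ₂} D.
boundarySteps : List ℕ → List Step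
boundarySteps []      = []
boundarySteps (a ∷ μ) = boundarySteps μ ++ (replicate (a ∸ head0 μ) R ++ (D ∷ []))

Point : Set
Point = ℕ × ℕ

move : Step → Point → Point
move R (x , y) = (suc x , y)
move D (x , y) = (x , y ∸ 1)

innerPts : Point → List Step → List Point
innerPts p []            = []
innerPts p (R ∷ D ∷ ss)  = move R p ∷ innerPts (move R p) (D ∷ ss)
innerPts p (R ∷ R ∷ ss)  = innerPts (move R p) (R ∷ ss)
innerPts p (R ∷ [])      = []
innerPts p (D ∷ ss)      = innerPts (move D p) ss

outerTurns : Point → List Step → List Point
outerTurns p []            = []
outerTurns p (D ∷ R ∷ ss)  = move D p ∷ outerTurns (move D p) (R ∷ ss)
outerTurns p (D ∷ D ∷ ss)  = outerTurns (move D p) (D ∷ ss)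
outerTurns p (D ∷ [])      = []
outerTurns p (R ∷ ss)      = outerTurns (move R p) ss

startPt : List ℕ → Point
startPt μ = (0 , length μ)

endPt : List ℕ → Point
endPt μ = (head0 μ , 0)

innerCorners : List ℕ → List Point
innerCorners μ = innerPts (startPt μ) (boundarySteps μ)

outerCorners : List ℕ → List Point
outerCorners μ = startPt μ ∷ endPt μ ∷ outerTurns (startPt μ) (boundarySteps μ)

-- Algebra over an arbitrary commutative ring; γ plays the role of √α and
-- δ the role of 1/√α (γ * δ ≈ 1 is assumed in the statement).
module RingDefs (Rg : CommutativeRing 0ℓ 0ℓ) where
  open CommutativeRing Rg

  fromℕ : ℕ → Carrier
  fromℕ zero    = 0#
  fromℕ (suc n) = 1# + fromℕ n

  fromℤ : ℤ → Carrier
  fromℤ (+ n)      = fromℕ n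
  fromℤ -[1+ n ]   = - fromℕ (suc n)

  pow : Carrier → ℕ → Carrier
  pow x zero    = 1#
  pow x (suc n) = x * pow x n

  -- polynomial with integer coefficients (constant term first), evaluated at x
  evalPoly : List ℤ → Carrier → Carrier
  evalPoly []       x = 0#
  evalPoly (c ∷ cs) x = fromℤ c + x * evalPoly cs x

  -- content of the image of (x,y) under (x,y) ↦ (γx, δy): γx − δy
  content : Carrier → Carrier → Point → Carrier
  content γ δ (x , y) = γ * fromℕ x - δ * fromℕ y

  mapC : Carrier → Carrier → List Point → List Carrier
  mapC γ δ []       = []
  mapC γ δ (p ∷ ps) = content γ δ p ∷ mapC γ δ ps

  Series : Set
  Series = ℕ → Carrier

  sumTo : ℕ → (ℕ → Carrier) → Carrier
  sumTo zero    f = f 0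
  sumTo (suc n) f = sumTo n f + f (suc n)

  _⊛_ : Series → Series → Series
  (f ⊛ g) n = sumTo n (λ a → f a * g (n ∸ a))

  oneS : Series
  oneS zero    = 1#
  oneS (suc _) = 0#

  linS : Carrier → Series
  linS c zero          = 1#
  linS c (suc zero)    = - c
  linS c (suc (suc _)) = 0#

  -- 1 / (1 − c z) = Σ cⁿ zⁿ
  geomS : Carrier → Series
  geomS c n = pow c n

  numS : List Carrier → Series
  numS []       = oneS
  numS (c ∷ cs) = linS c ⊛ numS cs

  denInvS : List Carrier → Series
  denInvS []       = oneS
  denInvS (c ∷ cs) = geomS c ⊛ denInvS cs

  moment : Carrier → Carrier → ℕ → List ℕ → Carrier
  moment γ δ k μ =
    (numS (mapC γ δ (innerCorners μ)) ⊛ denInvS (mapC γ δ (outerCorners μ))) k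

-- Put α = γ². Since γδ = 1, every content is γx − δy = δ(αx − y), so replacing z by δz shows
-- that M_k = δ^k P_k(α), where P_k is the k-th coefficient of the same generating function
-- built from the contents αx − y: a polynomial in α with integer coefficients. At α = 0 these
-- contents are −y, and every inner corner lies at the height of the outer corner preceding it
-- on the boundary, so the numerator cancels every denominator factor except that of the
-- endpoint (λ₁, 0), whose content is 0. Hence the generating function is 1 at α = 0,
-- P_k(0) = 0 for k ≥ 1, P_k(α) = α Q(α), and γ^(k−2) M_k = γ^(k−2) δ^k γ² Q(γ²) = Q(γ²).

module Submission where

open import Defs
open import Level using (0ℓ)
open import Data.Nat as ℕ using (ℕ; zero; suc; _≤_; _<_; _∸_; s≤s; z≤n)
import Data.Nat.Properties as ℕ
open import Data.Integer as ℤ using (ℤ; +_; -[1+_]; _⊖_; _◃_; sign; ∣_∣)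
import Data.Integer.Properties as ℤ
open import Data.Sign as Sign using (Sign)
open import Data.List using (List; []; _∷_; _++_; map; replicate; length; drop)
open import Data.List.Relation.Unary.All using (All; _∷_)
open import Data.List.Relation.Binary.Pointwise using (Pointwise; []; _∷_)
open import Data.Product using (Σ; ∃; _,_; proj₂)
import Data.Maybe as Maybe
open import Relation.Binary.Consequences using (dec⇒weaklyDec)
open import Relation.Binary.PropositionalEquality as ≡ using (_≡_)
open import Relation.Binary.Bundles using (Setoid)
open import Algebra.Bundles using (CommutativeRing)
import Algebra.Solver.Ring.AlmostCommutativeRing as ACR
import Algebra.Solver.Ring as RingSolver
import Relation.Binary.Reasoning.Setoid

heights : List Point → List ℕ
heights = map proj₂

data EndsInD : List Step → Set where
  [D] : EndsInD (D ∷ [])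
  _∷_ : ∀ s {ss} → EndsInD ss → EndsInD (s ∷ ss)

++-endsInD : ∀ xs {ys} → EndsInD ys → EndsInD (xs ++ ys)
++-endsInD []       e = e
++-endsInD (x ∷ xs) e = x ∷ ++-endsInD xs e

-- Every inner corner lies at the height of the outer corner preceding it.
mutual
  innerPts-heights-R : ∀ p ss → EndsInD (R ∷ ss) →
    heights (innerPts p (R ∷ ss)) ≡ proj₂ p ∷ heights (outerTurns p (R ∷ ss))
  innerPts-heights-R p       []       (_ ∷ ())
  innerPts-heights-R (x , y) (D ∷ ss) (_ ∷ e) = ≡.cong (y ∷_) (innerPts-heights-D (suc x , y) ss e)
  innerPts-heights-R (x , y) (R ∷ ss) (_ ∷ e) = innerPts-heights-R (suc x , y) ss e

  innerPts-heights-D : ∀ p ss → EndsInD (D ∷ ss) →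
    heights (innerPts p (D ∷ ss)) ≡ heights (outerTurns p (D ∷ ss))
  innerPts-heights-D p       []       _       = ≡.refl
  innerPts-heights-D (x , y) (R ∷ ss) (_ ∷ e) = innerPts-heights-R (x , y ∸ 1) ss e
  innerPts-heights-D (x , y) (D ∷ ss) (_ ∷ e) = innerPts-heights-D (x , y ∸ 1) ss e

boundarySteps-endsInD : ∀ a μ → EndsInD (boundarySteps (a ∷ μ))
boundarySteps-endsInD a μ =
  ++-endsInD (boundarySteps μ) (++-endsInD (replicate (a ∸ head0 μ) R) [D])

boundarySteps-startsWithR : ∀ a μ → All (0 <_) (a ∷ μ) →
  ∃ λ ss → boundarySteps (a ∷ μ) ≡ R ∷ ss
boundarySteps-startsWithR (suc a) []      _        = _ , ≡.refl
boundarySteps-startsWithR a       (b ∷ μ) (_ ∷ bμ) with boundarySteps-startsWithR b μ bμ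
... | ss , eq = _ , ≡.cong (_++ (replicate (a ∸ head0 (b ∷ μ)) R ++ (D ∷ []))) eq

innerCorners-heights : ∀ a μ → All (0 <_) (a ∷ μ) →
  heights (innerCorners (a ∷ μ))
    ≡ length (a ∷ μ) ∷ heights (outerTurns (startPt (a ∷ μ)) (boundarySteps (a ∷ μ)))
innerCorners-heights a μ pos with boundarySteps-startsWithR a μ pos | boundarySteps-endsInD a μ
... | ss , eq | e rewrite eq = innerPts-heights-R (startPt (a ∷ μ)) ss e

-- Integer polynomials, constant term first, as read by evalPoly.
ℤ[X] : Set
ℤ[X] = List ℤ

infixl 6 _+ᴾ_
infixl 7 _*ᴾ_ _·ᴾ_

_+ᴾ_ : ℤ[X] → ℤ[X] → ℤ[X]
[]      +ᴾ q       = q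
(a ∷ p) +ᴾ []      = a ∷ p
(a ∷ p) +ᴾ (b ∷ q) = (a ℤ.+ b) ∷ (p +ᴾ q)

-ᴾ_ : ℤ[X] → ℤ[X]
-ᴾ_ = map (λ a → ℤ.- a)

_·ᴾ_ : ℤ → ℤ[X] → ℤ[X]
c ·ᴾ p = map (c ℤ.*_) p

_*ᴾ_ : ℤ[X] → ℤ[X] → ℤ[X]
[]      *ᴾ q = []
(a ∷ p) *ᴾ q = a ·ᴾ q +ᴾ (+ 0 ∷ p *ᴾ q)

1ᴾ : ℤ[X]
1ᴾ = + 1 ∷ []

Seriesᴾ : Set
Seriesᴾ = ℕ → ℤ[X]

sumToᴾ : ℕ → (ℕ → ℤ[X]) → ℤ[X]
sumToᴾ zero    f = f 0
sumToᴾ (suc n) f = sumToᴾ n f +ᴾ f (suc n)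

_⊛ᴾ_ : Seriesᴾ → Seriesᴾ → Seriesᴾ
(f ⊛ᴾ g) n = sumToᴾ n (λ a → f a *ᴾ g (n ∸ a))

oneSᴾ : Seriesᴾ
oneSᴾ zero    = 1ᴾ
oneSᴾ (suc _) = []

linSᴾ : ℤ[X] → Seriesᴾ
linSᴾ c zero          = 1ᴾ
linSᴾ c (suc zero)    = -ᴾ c
linSᴾ c (suc (suc _)) = []

powᴾ : ℤ[X] → ℕ → ℤ[X]
powᴾ c zero    = 1ᴾ
powᴾ c (suc n) = c *ᴾ powᴾ c n

numSᴾ : List ℤ[X] → Seriesᴾ
numSᴾ []       = oneSᴾ
numSᴾ (c ∷ cs) = linSᴾ c ⊛ᴾ numSᴾ cs

denInvSᴾ : List ℤ[X] → Seriesᴾ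
denInvSᴾ []       = oneSᴾ
denInvSᴾ (c ∷ cs) = powᴾ c ⊛ᴾ denInvSᴾ cs

contentᴾ : Point → ℤ[X]
contentᴾ (x , y) = ℤ.- (+ y) ∷ + x ∷ []

momentsᴾ : List ℕ → Seriesᴾ
momentsᴾ μ =
  numSᴾ (map contentᴾ (innerCorners μ)) ⊛ᴾ denInvSᴾ (map contentᴾ (outerCorners μ))

module _ (Rg : CommutativeRing 0ℓ 0ℓ) where
  open CommutativeRing Rg
  open RingDefs Rg
  open import Algebra.Properties.Ring ring
    using (-‿distribʳ-*; -1*x≈-x; -0#≈0#; -‿involutive; -‿+-comm)
  module ≈-Reasoning = Relation.Binary.Reasoning.Setoid setoid

  open import Algebra.Properties.CommutativeSemigroup +-commutativeSemigroup
    using () renaming (interchange to +-interchange)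
  open import Algebra.Properties.CommutativeSemigroup *-commutativeSemigroup
    using () renaming (interchange to *-interchange)

  fromℕ-+ : ∀ m n → fromℕ (m ℕ.+ n) ≈ fromℕ m + fromℕ n
  fromℕ-+ zero    n = sym (+-identityˡ _)
  fromℕ-+ (suc m) n = trans (+-congˡ (fromℕ-+ m n)) (sym (+-assoc _ _ _))

  fromℕ-* : ∀ m n → fromℕ (m ℕ.* n) ≈ fromℕ m * fromℕ n
  fromℕ-* zero    n = sym (zeroˡ _)
  fromℕ-* (suc m) n = begin
    fromℕ (n ℕ.+ m ℕ.* n)             ≈⟨ fromℕ-+ n (m ℕ.* n) ⟩
    fromℕ n + fromℕ (m ℕ.* n)         ≈⟨ +-cong (sym (*-identityˡ _)) (fromℕ-* m n) ⟩
    1# * fromℕ n + fromℕ m * fromℕ n  ≈⟨ sym (distribʳ _ _ _) ⟩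
    (1# + fromℕ m) * fromℕ n          ∎
    where open ≈-Reasoning

  fromℤ-⊖ : ∀ m n → fromℤ (m ⊖ n) ≈ fromℕ m - fromℕ n
  fromℤ-⊖ m       zero    = trans (reflexive (≡.cong fromℤ (ℤ.⊖-≥ {m} z≤n)))
                                  (sym (trans (+-congˡ -0#≈0#) (+-identityʳ _)))
  fromℤ-⊖ zero    (suc n) = trans (reflexive (≡.cong fromℤ (ℤ.⊖-≤ {0} {suc n} z≤n)))
                                  (sym (+-identityˡ _))
  fromℤ-⊖ (suc m) (suc n) = begin
    fromℤ (suc m ⊖ suc n)               ≡⟨ ≡.cong fromℤ (ℤ.[1+m]⊖[1+n]≡m⊖n m n) ⟩
    fromℤ (m ⊖ n)                       ≈⟨ fromℤ-⊖ m n ⟩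
    fromℕ m - fromℕ n                   ≈⟨ +-identityˡ _ ⟨
    0# + (fromℕ m - fromℕ n)            ≈⟨ +-congʳ (-‿inverseʳ 1#) ⟨
    (1# - 1#) + (fromℕ m - fromℕ n)     ≈⟨ +-interchange _ _ _ _ ⟩
    (1# + fromℕ m) + (- 1# - fromℕ n)   ≈⟨ +-congˡ (-‿+-comm _ _) ⟩
    (1# + fromℕ m) - (1# + fromℕ n)     ∎
    where open ≈-Reasoning

  fromℤ-+ : ∀ i j → fromℤ (i ℤ.+ j) ≈ fromℤ i + fromℤ j
  fromℤ-+ (+ m)    (+ n)    = fromℕ-+ m n
  fromℤ-+ (+ m)    -[1+ n ] = fromℤ-⊖ m (suc n)
  fromℤ-+ -[1+ m ] (+ n)    = trans (fromℤ-⊖ n (suc m)) (+-comm _ _)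
  fromℤ-+ -[1+ m ] -[1+ n ] = begin
    - fromℕ (suc (suc (m ℕ.+ n)))     ≡⟨ ≡.cong (λ k → - fromℕ (suc k)) (ℕ.+-suc m n) ⟨
    - fromℕ (suc m ℕ.+ suc n)         ≈⟨ -‿cong (fromℕ-+ (suc m) (suc n)) ⟩
    - (fromℕ (suc m) + fromℕ (suc n)) ≈⟨ -‿+-comm _ _ ⟨
    - fromℕ (suc m) + - fromℕ (suc n) ∎
    where open ≈-Reasoning

  fromℤ-neg : ∀ i → fromℤ (ℤ.- i) ≈ - fromℤ i
  fromℤ-neg (+ zero)  = sym -0#≈0#
  fromℤ-neg (+ suc n) = refl
  fromℤ-neg -[1+ n ]  = sym (-‿involutive _)

  fromSign : Sign → Carrier
  fromSign Sign.+ = 1#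
  fromSign Sign.- = - 1#

  fromSign-* : ∀ s t → fromSign (s Sign.* t) ≈ fromSign s * fromSign t
  fromSign-* Sign.+ t      = sym (*-identityˡ _)
  fromSign-* Sign.- Sign.+ = sym (*-identityʳ _)
  fromSign-* Sign.- Sign.- = sym (trans (-1*x≈-x _) (-‿involutive _))

  fromℤ-◃ : ∀ s n → fromℤ (s ◃ n) ≈ fromSign s * fromℕ n
  fromℤ-◃ s      zero    = sym (zeroʳ _)
  fromℤ-◃ Sign.+ (suc n) = sym (*-identityˡ _)
  fromℤ-◃ Sign.- (suc n) = sym (-1*x≈-x _)

  fromℤ-sign-abs : ∀ i → fromℤ i ≈ fromSign (sign i) * fromℕ ∣ i ∣
  fromℤ-sign-abs i =
    trans (reflexive (≡.cong fromℤ (≡.sym (ℤ.◃-inverse i)))) (fromℤ-◃ (sign i) ∣ i ∣)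

  fromℤ-* : ∀ i j → fromℤ (i ℤ.* j) ≈ fromℤ i * fromℤ j
  fromℤ-* i j = begin
    fromℤ (i ℤ.* j)
      ≈⟨ fromℤ-◃ (sign i Sign.* sign j) (∣ i ∣ ℕ.* ∣ j ∣) ⟩
    fromSign (sign i Sign.* sign j) * fromℕ (∣ i ∣ ℕ.* ∣ j ∣)
      ≈⟨ *-cong (fromSign-* (sign i) (sign j)) (fromℕ-* ∣ i ∣ ∣ j ∣) ⟩
    (fromSign (sign i) * fromSign (sign j)) * (fromℕ ∣ i ∣ * fromℕ ∣ j ∣)
      ≈⟨ *-interchange _ _ _ _ ⟩
    (fromSign (sign i) * fromℕ ∣ i ∣) * (fromSign (sign j) * fromℕ ∣ j ∣)
      ≈⟨ *-cong (fromℤ-sign-abs i) (fromℤ-sign-abs j) ⟨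
    fromℤ i * fromℤ j
      ∎
    where open ≈-Reasoning

  fromℤ-homomorphism : ℤ.+-*-rawRing ACR.-Raw-AlmostCommutative⟶ ACR.fromCommutativeRing Rg
  fromℤ-homomorphism = record
    { ⟦_⟧    = fromℤ
    ; +-homo = fromℤ-+
    ; *-homo = fromℤ-*
    ; -‿homo = fromℤ-neg
    ; 0-homo = refl
    ; 1-homo = +-identityʳ 1#
    }

  open RingSolver ℤ.+-*-rawRing (ACR.fromCommutativeRing Rg) fromℤ-homomorphism
    (λ i j → Maybe.map (λ i≡j → reflexive (≡.cong fromℤ i≡j)) (dec⇒weaklyDec ℤ._≟_ i j))
    using (solve; _:=_; _:+_; _:-_; _:*_; :-_; con)

  pow-cong : ∀ {a b} n → a ≈ b → pow a n ≈ pow b n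
  pow-cong zero    _   = refl
  pow-cong (suc n) a≈b = *-cong a≈b (pow-cong n a≈b)

  pow-+ : ∀ a m n → pow a (m ℕ.+ n) ≈ pow a m * pow a n
  pow-+ a zero    n = sym (*-identityˡ _)
  pow-+ a (suc m) n = trans (*-congˡ (pow-+ a m n)) (sym (*-assoc _ _ _))

  pow-distrib-* : ∀ a b n → pow (a * b) n ≈ pow a n * pow b n
  pow-distrib-* a b zero    = sym (*-identityˡ 1#)
  pow-distrib-* a b (suc n) = trans (*-congˡ (pow-distrib-* a b n)) (*-interchange _ _ _ _)

  pow-1# : ∀ n → pow 1# n ≈ 1#
  pow-1# zero    = refl
  pow-1# (suc n) = trans (*-identityˡ _) (pow-1# n)

  infix 4 _≋_
  _≋_ : Series → Series → Set
  f ≋ g = ∀ n → f n ≈ g n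

  ≋-setoid : Setoid 0ℓ 0ℓ
  ≋-setoid = record
    { Carrier       = Series
    ; _≈_           = _≋_
    ; isEquivalence = record
      { refl  = λ _ → refl
      ; sym   = λ f≋g n → sym (f≋g n)
      ; trans = λ f≋g g≋h n → trans (f≋g n) (g≋h n)
      }
    }

  module ≋ = Setoid ≋-setoid using (refl; trans)
  module ≋-Reasoning = Relation.Binary.Reasoning.Setoid ≋-setoid

  sumTo-cong : ∀ n {f g : ℕ → Carrier} → (∀ a → a ≤ n → f a ≈ g a) →
    sumTo n f ≈ sumTo n g
  sumTo-cong zero    f≈g = f≈g 0 z≤n
  sumTo-cong (suc n) f≈g =
    +-cong (sumTo-cong n (λ a a≤n → f≈g a (ℕ.m≤n⇒m≤1+n a≤n))) (f≈g (suc n) ℕ.≤-refl)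

  sumTo-suc : ∀ n (f : ℕ → Carrier) → sumTo (suc n) f ≈ f 0 + sumTo n (λ a → f (suc a))
  sumTo-suc zero    f = refl
  sumTo-suc (suc n) f = trans (+-congʳ (sumTo-suc n f)) (+-assoc _ _ _)

  sumTo-+ : ∀ n (f g : ℕ → Carrier) → sumTo n (λ a → f a + g a) ≈ sumTo n f + sumTo n g
  sumTo-+ zero    f g = refl
  sumTo-+ (suc n) f g = trans (+-congʳ (sumTo-+ n f g)) (+-interchange _ _ _ _)

  sumTo-*ˡ : ∀ n c (f : ℕ → Carrier) → sumTo n (λ a → c * f a) ≈ c * sumTo n f
  sumTo-*ˡ zero    c f = refl
  sumTo-*ˡ (suc n) c f = trans (+-congʳ (sumTo-*ˡ n c f)) (sym (distribˡ _ _ _))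

  sumTo-0# : ∀ n → sumTo n (λ _ → 0#) ≈ 0#
  sumTo-0# zero    = refl
  sumTo-0# (suc n) = trans (+-identityʳ _) (sumTo-0# n)

  sumTo-reverse : ∀ n (f : ℕ → Carrier) → sumTo n f ≈ sumTo n (λ a → f (n ∸ a))
  sumTo-reverse zero    f = refl
  sumTo-reverse (suc n) f = begin
    sumTo n f + f (suc n)                    ≈⟨ +-congʳ (sumTo-reverse n f) ⟩
    sumTo n (λ a → f (n ∸ a)) + f (suc n)    ≈⟨ +-comm _ _ ⟩
    f (suc n) + sumTo n (λ a → f (n ∸ a))    ≈⟨ sumTo-suc n (λ a → f (suc n ∸ a)) ⟨
    sumTo (suc n) (λ a → f (suc n ∸ a))      ∎
    where open ≈-Reasoning

  ⊛-cong : ∀ {f f′ g g′} → f ≋ f′ → g ≋ g′ → f ⊛ g ≋ f′ ⊛ g′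
  ⊛-cong f≋f′ g≋g′ n = sumTo-cong n (λ a _ → *-cong (f≋f′ a) (g≋g′ (n ∸ a)))

  ⊛-suc : ∀ f g n → (f ⊛ g) (suc n) ≈ f 0 * g (suc n) + ((λ m → f (suc m)) ⊛ g) n
  ⊛-suc f g n = sumTo-suc n _

  ⊛-comm : ∀ f g → f ⊛ g ≋ g ⊛ f
  ⊛-comm f g n = trans (sumTo-reverse n _) (sumTo-cong n λ a a≤n →
    trans (*-comm _ _) (*-congʳ (reflexive (≡.cong g (ℕ.m∸[m∸n]≡n a≤n)))))

  ⊛-zeroˡ : ∀ g → (λ _ → 0#) ⊛ g ≋ (λ _ → 0#)
  ⊛-zeroˡ g n = trans (sumTo-cong n (λ a _ → zeroˡ _)) (sumTo-0# n)

  ⊛-linearˡ : ∀ c f h g n → ((λ m → c * f m + h m) ⊛ g) n ≈ c * (f ⊛ g) n + (h ⊛ g) n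
  ⊛-linearˡ c f h g n = begin
    sumTo n (λ a → (c * f a + h a) * g (n ∸ a))
      ≈⟨ sumTo-cong n (λ a _ → trans (distribʳ _ _ _) (+-congʳ (*-assoc _ _ _))) ⟩
    sumTo n (λ a → c * (f a * g (n ∸ a)) + h a * g (n ∸ a))
      ≈⟨ sumTo-+ n _ _ ⟩
    sumTo n (λ a → c * (f a * g (n ∸ a))) + (h ⊛ g) n
      ≈⟨ +-congʳ (sumTo-*ˡ n c _) ⟩
    c * (f ⊛ g) n + (h ⊛ g) n
      ∎
    where open ≈-Reasoning

  ⊛-assoc : ∀ f g h → (f ⊛ g) ⊛ h ≋ f ⊛ (g ⊛ h)
  ⊛-assoc f g h zero    = *-assoc _ _ _
  ⊛-assoc f g h (suc n) = begin
    ((f ⊛ g) ⊛ h) (suc n)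
      ≈⟨ ⊛-suc (f ⊛ g) h n ⟩
    (f 0 * g 0) * h (suc n) + ((λ m → (f ⊛ g) (suc m)) ⊛ h) n
      ≈⟨ +-congˡ (⊛-cong {g = h} (λ m → ⊛-suc f g m) (λ _ → refl) n) ⟩
    (f 0 * g 0) * h (suc n) + ((λ m → f 0 * g′ m + (f′ ⊛ g) m) ⊛ h) n
      ≈⟨ +-congˡ (⊛-linearˡ (f 0) g′ (f′ ⊛ g) h n) ⟩
    (f 0 * g 0) * h (suc n) + (f 0 * (g′ ⊛ h) n + ((f′ ⊛ g) ⊛ h) n)
      ≈⟨ +-congˡ (+-congˡ (⊛-assoc f′ g h n)) ⟩
    (f 0 * g 0) * h (suc n) + (f 0 * (g′ ⊛ h) n + (f′ ⊛ (g ⊛ h)) n)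
      ≈⟨ solve 5 (λ a b c d e → (a :* b) :* c :+ (a :* d :+ e) := a :* (b :* c :+ d) :+ e)
               refl _ _ _ _ _ ⟩
    f 0 * (g 0 * h (suc n) + (g′ ⊛ h) n) + (f′ ⊛ (g ⊛ h)) n
      ≈⟨ +-congʳ (*-congˡ (⊛-suc g h n)) ⟨
    f 0 * (g ⊛ h) (suc n) + (f′ ⊛ (g ⊛ h)) n
      ≈⟨ ⊛-suc f (g ⊛ h) n ⟨
    (f ⊛ (g ⊛ h)) (suc n)
      ∎
    where
    open ≈-Reasoning
    f′ g′ : Series
    f′ m = f (suc m)
    g′ m = g (suc m)

  oneS-⊛ : ∀ f → oneS ⊛ f ≋ f
  oneS-⊛ f zero    = *-identityˡ _
  oneS-⊛ f (suc n) =
    trans (⊛-suc oneS f n) (trans (+-cong (*-identityˡ _) (⊛-zeroˡ f n)) (+-identityʳ _))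

  ⊛-medial : ∀ f g h k → (f ⊛ g) ⊛ (h ⊛ k) ≋ (f ⊛ h) ⊛ (g ⊛ k)
  ⊛-medial f g h k = begin
    (f ⊛ g) ⊛ (h ⊛ k)   ≈⟨ ⊛-assoc f g (h ⊛ k) ⟩
    f ⊛ (g ⊛ (h ⊛ k))   ≈⟨ ⊛-cong {f} ≋.refl (⊛-assoc g h k) ⟨
    f ⊛ ((g ⊛ h) ⊛ k)   ≈⟨ ⊛-cong {f} ≋.refl (⊛-cong (⊛-comm g h) (≋.refl {k})) ⟩
    f ⊛ ((h ⊛ g) ⊛ k)   ≈⟨ ⊛-cong {f} ≋.refl (⊛-assoc h g k) ⟩
    f ⊛ (h ⊛ (g ⊛ k))   ≈⟨ ⊛-assoc f h (g ⊛ k) ⟨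
    (f ⊛ h) ⊛ (g ⊛ k)   ∎
    where open ≋-Reasoning

  geomS-0# : ∀ {c} → c ≈ 0# → geomS c ≋ oneS
  geomS-0# c≈0 zero    = refl
  geomS-0# c≈0 (suc n) = trans (*-congʳ c≈0) (zeroˡ _)

  linS-⊛-geomS : ∀ c → linS c ⊛ geomS c ≋ oneS
  linS-⊛-geomS c zero    = *-identityˡ _
  linS-⊛-geomS c (suc n) = begin
    (linS c ⊛ geomS c) (suc n)                  ≈⟨ ⊛-suc (linS c) (geomS c) n ⟩
    1# * (c * pow c n) + (tailLin ⊛ geomS c) n  ≈⟨ +-congˡ (tailLin-⊛-geomS n) ⟩
    1# * (c * pow c n) + - c * pow c n          ≈⟨ +-congʳ (*-identityˡ _) ⟩
    c * pow c n + - c * pow c n                 ≈⟨ solve 2 (λ c p → c :* p :+ :- c :* p := con (+ 0))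
                                                           refl c (pow c n) ⟩
    0#                                          ∎
    where
    open ≈-Reasoning
    tailLin : Series
    tailLin m = linS c (suc m)
    tailLin-⊛-geomS : ∀ n → (tailLin ⊛ geomS c) n ≈ - c * pow c n
    tailLin-⊛-geomS zero    = refl
    tailLin-⊛-geomS (suc n) =
      trans (⊛-suc tailLin (geomS c) n) (trans (+-congˡ (⊛-zeroˡ (geomS c) n)) (+-identityʳ _))

  numS-cong : ∀ {cs cs′} → Pointwise _≈_ cs cs′ → numS cs ≋ numS cs′
  numS-cong []                      = ≋.refl
  numS-cong (_∷_ {c} {c′} c≈c′ cs≈) = ⊛-cong linS-cong (numS-cong cs≈)
    where
    linS-cong : linS c ≋ linS c′
    linS-cong zero          = refl
    linS-cong (suc zero)    = -‿cong c≈c′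
    linS-cong (suc (suc n)) = refl

  denInvS-cong : ∀ {cs cs′} → Pointwise _≈_ cs cs′ → denInvS cs ≋ denInvS cs′
  denInvS-cong []           = ≋.refl
  denInvS-cong (c≈c′ ∷ cs≈) = ⊛-cong (λ n → pow-cong n c≈c′) (denInvS-cong cs≈)

  numS-⊛-denInvS-cancel : ∀ c cs ds → numS (c ∷ cs) ⊛ denInvS (c ∷ ds) ≋ numS cs ⊛ denInvS ds
  numS-⊛-denInvS-cancel c cs ds = begin
    (linS c ⊛ numS cs) ⊛ (geomS c ⊛ denInvS ds)
      ≈⟨ ⊛-medial (linS c) (numS cs) (geomS c) (denInvS ds) ⟩
    (linS c ⊛ geomS c) ⊛ (numS cs ⊛ denInvS ds)
      ≈⟨ ⊛-cong (linS-⊛-geomS c) (≋.refl {numS cs ⊛ denInvS ds}) ⟩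
    oneS ⊛ (numS cs ⊛ denInvS ds)
      ≈⟨ oneS-⊛ _ ⟩
    numS cs ⊛ denInvS ds
      ∎
    where open ≋-Reasoning

  denInvS-0#∷ : ∀ {e} → e ≈ 0# → ∀ ds → denInvS (e ∷ ds) ≋ denInvS ds
  denInvS-0#∷ e≈0 ds =
    ≋.trans (⊛-cong (geomS-0# e≈0) (≋.refl {denInvS ds})) (oneS-⊛ (denInvS ds))

  numS-⊛-denInvS-self : ∀ cs → numS cs ⊛ denInvS cs ≋ oneS
  numS-⊛-denInvS-self []       = oneS-⊛ oneS
  numS-⊛-denInvS-self (c ∷ cs) = ≋.trans (numS-⊛-denInvS-cancel c cs cs) (numS-⊛-denInvS-self cs)

  contentα : Carrier → Point → Carrier
  contentα α (x , y) = α * fromℕ x - fromℕ y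

  momentsα : Carrier → List ℕ → Series
  momentsα α μ =
    numS (map (contentα α) (innerCorners μ)) ⊛ denInvS (map (contentα α) (outerCorners μ))

  contentα-0# : ∀ ps → Pointwise _≈_ (map (contentα 0#) ps) (map (λ y → - fromℕ y) (heights ps))
  contentα-0# []            = []
  contentα-0# ((x , y) ∷ ps) = trans (+-congʳ (zeroˡ _)) (+-identityˡ _) ∷ contentα-0# ps

  momentsα-0# : ∀ μ → All (0 <_) μ → momentsα 0# μ ≋ oneS
  momentsα-0# μ pos =
    ≋.trans (⊛-cong (numS-cong (contentα-0# (innerCorners μ)))
                    (denInvS-cong (contentα-0# (outerCorners μ))))
            (cancel μ pos)
    where
    negate : List ℕ → List Carrier
    negate = map (λ y → - fromℕ y)
    cancel : ∀ μ → All (0 <_) μ →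
      numS (negate (heights (innerCorners μ))) ⊛ denInvS (negate (heights (outerCorners μ))) ≋ oneS
    cancel []      _   = ≋.trans (⊛-cong {oneS} ≋.refl (≋.trans (denInvS-0#∷ -0#≈0# (- 0# ∷ []))
                                                                 (denInvS-0#∷ -0#≈0# [])))
                                 (numS-⊛-denInvS-self [])
    cancel (a ∷ μ) pos rewrite innerCorners-heights a μ pos =
      ≋.trans (numS-⊛-denInvS-cancel _ hs (- 0# ∷ hs))
        (≋.trans (⊛-cong {numS hs} ≋.refl (denInvS-0#∷ -0#≈0# hs)) (numS-⊛-denInvS-self hs))
      where
      hs : List Carrier
      hs = negate (heights (outerTurns (startPt (a ∷ μ)) (boundarySteps (a ∷ μ))))

  -- f(z) = g(δz) as formal power series.
  Dilated : Carrier → Series → Series → Set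
  Dilated δ f g = ∀ n → f n ≈ pow δ n * g n

  ⊛-dilated : ∀ {δ f f′ g g′} → Dilated δ f f′ → Dilated δ g g′ → Dilated δ (f ⊛ g) (f′ ⊛ g′)
  ⊛-dilated {δ} {f} {f′} {g} {g′} f≈ g≈ n =
    trans (sumTo-cong n term) (sumTo-*ˡ n (pow δ n) (λ a → f′ a * g′ (n ∸ a)))
    where
    open ≈-Reasoning
    term : ∀ a → a ≤ n → f a * g (n ∸ a) ≈ pow δ n * (f′ a * g′ (n ∸ a))
    term a a≤n = begin
      f a * g (n ∸ a)
        ≈⟨ *-cong (f≈ a) (g≈ (n ∸ a)) ⟩
      (pow δ a * f′ a) * (pow δ (n ∸ a) * g′ (n ∸ a))
        ≈⟨ *-interchange _ _ _ _ ⟩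
      (pow δ a * pow δ (n ∸ a)) * (f′ a * g′ (n ∸ a))
        ≈⟨ *-congʳ (pow-+ δ a (n ∸ a)) ⟨
      pow δ (a ℕ.+ (n ∸ a)) * (f′ a * g′ (n ∸ a))
        ≈⟨ *-congʳ (reflexive (≡.cong (pow δ) (ℕ.m+[n∸m]≡n a≤n))) ⟩
      pow δ n * (f′ a * g′ (n ∸ a))
        ∎

  oneS-dilated : ∀ δ → Dilated δ oneS oneS
  oneS-dilated δ zero    = sym (*-identityˡ 1#)
  oneS-dilated δ (suc n) = sym (zeroʳ _)

  linS-dilated : ∀ {δ c c′} → c ≈ δ * c′ → Dilated δ (linS c) (linS c′)
  linS-dilated         c≈ zero          = sym (*-identityˡ 1#)
  linS-dilated {δ} {c} {c′} c≈ (suc zero) = begin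
    - c               ≈⟨ -‿cong c≈ ⟩
    - (δ * c′)        ≈⟨ -‿distribʳ-* δ c′ ⟩
    δ * - c′          ≈⟨ *-congʳ (*-identityʳ δ) ⟨
    (δ * 1#) * - c′   ∎
    where open ≈-Reasoning
  linS-dilated         c≈ (suc (suc n)) = sym (zeroʳ _)

  geomS-dilated : ∀ {δ c c′} → c ≈ δ * c′ → Dilated δ (geomS c) (geomS c′)
  geomS-dilated {δ} {c} {c′} c≈ n = trans (pow-cong n c≈) (pow-distrib-* δ c′ n)

  numS-dilated : ∀ {δ cs cs′} → Pointwise (λ c c′ → c ≈ δ * c′) cs cs′ →
    Dilated δ (numS cs) (numS cs′)
  numS-dilated {δ} []         = oneS-dilated δ
  numS-dilated     (c≈ ∷ cs≈) = ⊛-dilated (linS-dilated c≈) (numS-dilated cs≈)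

  denInvS-dilated : ∀ {δ cs cs′} → Pointwise (λ c c′ → c ≈ δ * c′) cs cs′ →
    Dilated δ (denInvS cs) (denInvS cs′)
  denInvS-dilated {δ} []         = oneS-dilated δ
  denInvS-dilated     (c≈ ∷ cs≈) = ⊛-dilated (geomS-dilated c≈) (denInvS-dilated cs≈)

  content-dilated : ∀ {γ δ} → γ * δ ≈ 1# → ∀ p → content γ δ p ≈ δ * contentα (γ * γ) p
  content-dilated {γ} {δ} γδ≈1 (x , y) = begin
    γ * fromℕ x - δ * fromℕ y               ≈⟨ +-congʳ (*-identityˡ _) ⟨
    1# * (γ * fromℕ x) - δ * fromℕ y        ≈⟨ +-congʳ (*-congʳ γδ≈1) ⟨
    (γ * δ) * (γ * fromℕ x) - δ * fromℕ y   ≈⟨ solve 4 (λ g d X Y → (g :* d) :* (g :* X) :- d :* Y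
                                                        := d :* ((g :* g) :* X :- Y))
                                                 refl γ δ (fromℕ x) (fromℕ y) ⟩
    δ * ((γ * γ) * fromℕ x - fromℕ y)       ∎
    where open ≈-Reasoning

  mapC-dilated : ∀ {γ δ} → γ * δ ≈ 1# → ∀ ps →
    Pointwise (λ c c′ → c ≈ δ * c′) (mapC γ δ ps) (map (contentα (γ * γ)) ps)
  mapC-dilated γδ≈1 []       = []
  mapC-dilated γδ≈1 (p ∷ ps) = content-dilated γδ≈1 p ∷ mapC-dilated γδ≈1 ps

  moment-dilated : ∀ {γ δ} → γ * δ ≈ 1# → ∀ μ →
    Dilated δ (λ k → moment γ δ k μ) (momentsα (γ * γ) μ)
  moment-dilated γδ≈1 μ = ⊛-dilated (numS-dilated (mapC-dilated γδ≈1 (innerCorners μ)))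
                                    (denInvS-dilated (mapC-dilated γδ≈1 (outerCorners μ)))

  module _ (x : Carrier) where
    evalPoly-+ᴾ : ∀ p q → evalPoly (p +ᴾ q) x ≈ evalPoly p x + evalPoly q x
    evalPoly-+ᴾ []      q       = sym (+-identityˡ _)
    evalPoly-+ᴾ (a ∷ p) []      = sym (+-identityʳ _)
    evalPoly-+ᴾ (a ∷ p) (b ∷ q) =
      trans (+-cong (fromℤ-+ a b) (*-congˡ (evalPoly-+ᴾ p q)))
        (solve 5 (λ a b x p q → (a :+ b) :+ x :* (p :+ q) := (a :+ x :* p) :+ (b :+ x :* q))
           refl (fromℤ a) (fromℤ b) x (evalPoly p x) (evalPoly q x))

    evalPoly--ᴾ : ∀ p → evalPoly (-ᴾ p) x ≈ - evalPoly p x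
    evalPoly--ᴾ []      = sym -0#≈0#
    evalPoly--ᴾ (a ∷ p) =
      trans (+-cong (fromℤ-neg a) (*-congˡ (evalPoly--ᴾ p)))
        (solve 3 (λ a x p → :- a :+ x :* (:- p) := :- (a :+ x :* p))
           refl (fromℤ a) x (evalPoly p x))

    evalPoly-·ᴾ : ∀ c p → evalPoly (c ·ᴾ p) x ≈ fromℤ c * evalPoly p x
    evalPoly-·ᴾ c []      = sym (zeroʳ _)
    evalPoly-·ᴾ c (a ∷ p) =
      trans (+-cong (fromℤ-* c a) (*-congˡ (evalPoly-·ᴾ c p)))
        (solve 4 (λ c a x p → c :* a :+ x :* (c :* p) := c :* (a :+ x :* p))
           refl (fromℤ c) (fromℤ a) x (evalPoly p x))

    evalPoly-*ᴾ : ∀ p q → evalPoly (p *ᴾ q) x ≈ evalPoly p x * evalPoly q x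
    evalPoly-*ᴾ []      q = sym (zeroˡ _)
    evalPoly-*ᴾ (a ∷ p) q =
      trans (evalPoly-+ᴾ (a ·ᴾ q) (+ 0 ∷ p *ᴾ q))
        (trans (+-cong (evalPoly-·ᴾ a q) (+-congˡ (*-congˡ (evalPoly-*ᴾ p q))))
          (solve 4 (λ a x p q → a :* q :+ (con (+ 0) :+ x :* (p :* q)) := (a :+ x :* p) :* q)
             refl (fromℤ a) x (evalPoly p x) (evalPoly q x)))

    evalPoly-1ᴾ : evalPoly 1ᴾ x ≈ 1#
    evalPoly-1ᴾ = trans (+-cong (+-identityʳ 1#) (zeroʳ x)) (+-identityʳ 1#)

    evalSeries : Seriesᴾ → Series
    evalSeries f n = evalPoly (f n) x

    evalPoly-sumToᴾ : ∀ n f → evalPoly (sumToᴾ n f) x ≈ sumTo n (λ a → evalPoly (f a) x)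
    evalPoly-sumToᴾ zero    f = refl
    evalPoly-sumToᴾ (suc n) f =
      trans (evalPoly-+ᴾ (sumToᴾ n f) (f (suc n))) (+-congʳ (evalPoly-sumToᴾ n f))

    evalSeries-⊛ᴾ : ∀ f g → evalSeries (f ⊛ᴾ g) ≋ evalSeries f ⊛ evalSeries g
    evalSeries-⊛ᴾ f g n =
      trans (evalPoly-sumToᴾ n _) (sumTo-cong n (λ a _ → evalPoly-*ᴾ (f a) (g (n ∸ a))))

    evalSeries-oneSᴾ : evalSeries oneSᴾ ≋ oneS
    evalSeries-oneSᴾ zero    = evalPoly-1ᴾ
    evalSeries-oneSᴾ (suc n) = refl

    evalSeries-linSᴾ : ∀ c → evalSeries (linSᴾ c) ≋ linS (evalPoly c x)
    evalSeries-linSᴾ c zero          = evalPoly-1ᴾ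
    evalSeries-linSᴾ c (suc zero)    = evalPoly--ᴾ c
    evalSeries-linSᴾ c (suc (suc n)) = refl

    evalSeries-powᴾ : ∀ c → evalSeries (powᴾ c) ≋ geomS (evalPoly c x)
    evalSeries-powᴾ c zero    = evalPoly-1ᴾ
    evalSeries-powᴾ c (suc n) = trans (evalPoly-*ᴾ c (powᴾ c n)) (*-congˡ (evalSeries-powᴾ c n))

    evalSeries-numSᴾ : ∀ cs → evalSeries (numSᴾ cs) ≋ numS (map (λ c → evalPoly c x) cs)
    evalSeries-numSᴾ []       = evalSeries-oneSᴾ
    evalSeries-numSᴾ (c ∷ cs) = ≋.trans (evalSeries-⊛ᴾ (linSᴾ c) (numSᴾ cs))
      (⊛-cong (evalSeries-linSᴾ c) (evalSeries-numSᴾ cs))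

    evalSeries-denInvSᴾ : ∀ cs → evalSeries (denInvSᴾ cs) ≋ denInvS (map (λ c → evalPoly c x) cs)
    evalSeries-denInvSᴾ []       = evalSeries-oneSᴾ
    evalSeries-denInvSᴾ (c ∷ cs) = ≋.trans (evalSeries-⊛ᴾ (powᴾ c) (denInvSᴾ cs))
      (⊛-cong (evalSeries-powᴾ c) (evalSeries-denInvSᴾ cs))

    evalPoly-contentᴾ : ∀ ps →
      Pointwise _≈_ (map (λ c → evalPoly c x) (map contentᴾ ps)) (map (contentα x) ps)
    evalPoly-contentᴾ []             = []
    evalPoly-contentᴾ ((a , b) ∷ ps) =
      trans (+-cong (fromℤ-neg (+ b)) (*-congˡ (trans (+-congˡ (zeroʳ x)) (+-identityʳ _))))
        (+-comm _ _)
      ∷ evalPoly-contentᴾ ps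

    evalSeries-momentsᴾ : ∀ μ → evalSeries (momentsᴾ μ) ≋ momentsα x μ
    evalSeries-momentsᴾ μ = begin
      evalSeries (numSᴾ inner ⊛ᴾ denInvSᴾ outer)
        ≈⟨ evalSeries-⊛ᴾ (numSᴾ inner) (denInvSᴾ outer) ⟩
      evalSeries (numSᴾ inner) ⊛ evalSeries (denInvSᴾ outer)
        ≈⟨ ⊛-cong (≋.trans (evalSeries-numSᴾ inner)
                           (numS-cong (evalPoly-contentᴾ (innerCorners μ))))
                  (≋.trans (evalSeries-denInvSᴾ outer)
                           (denInvS-cong (evalPoly-contentᴾ (outerCorners μ)))) ⟩
      momentsα x μ
        ∎
      where
      open ≋-Reasoning
      inner outer : List ℤ[X]
      inner = map contentᴾ (innerCorners μ)
      outer = map contentᴾ (outerCorners μ)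

  evalPoly-drop-1 : ∀ p x → evalPoly p 0# ≈ 0# → evalPoly p x ≈ x * evalPoly (drop 1 p) x
  evalPoly-drop-1 []      x _     = sym (zeroʳ _)
  evalPoly-drop-1 (c ∷ p) x p0≈0 = trans (+-congʳ c≈0) (+-identityˡ _)
    where
    c≈0 : fromℤ c ≈ 0#
    c≈0 = trans (sym (trans (+-congˡ (zeroˡ _)) (+-identityʳ _))) p0≈0

  pow-*-inverse : ∀ {γ δ} → γ * δ ≈ 1# → ∀ n → pow γ n * pow δ n ≈ 1#
  pow-*-inverse {γ} {δ} γδ≈1 n =
    trans (sym (pow-distrib-* γ δ n)) (trans (pow-cong n γδ≈1) (pow-1# n))

  moment-polynomial : ∀ {γ δ} → γ * δ ≈ 1# → ∀ j μ → All (0 <_) μ →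
    pow γ j * moment γ δ (2 ℕ.+ j) μ ≈ evalPoly (drop 1 (momentsᴾ μ (2 ℕ.+ j))) (γ * γ)
  moment-polynomial {γ} {δ} γδ≈1 j μ pos = begin
    pow γ j * moment γ δ (2 ℕ.+ j) μ
      ≈⟨ *-congˡ (moment-dilated γδ≈1 μ (2 ℕ.+ j)) ⟩
    pow γ j * (pow δ (2 ℕ.+ j) * momentsα (γ * γ) μ (2 ℕ.+ j))
      ≈⟨ *-congˡ (*-congˡ (trans (sym (evalSeries-momentsᴾ (γ * γ) μ (2 ℕ.+ j)))
                                 (evalPoly-drop-1 P (γ * γ) P[0]≈0))) ⟩
    pow γ j * ((δ * (δ * pow δ j)) * ((γ * γ) * Q))
      ≈⟨ solve 5 (λ γʲ δʲ γ δ Q → γʲ :* ((δ :* (δ :* δʲ)) :* ((γ :* γ) :* Q))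
                                  := (γʲ :* δʲ) :* ((γ :* δ) :* ((γ :* δ) :* Q)))
               refl (pow γ j) (pow δ j) γ δ Q ⟩
    (pow γ j * pow δ j) * ((γ * δ) * ((γ * δ) * Q))
      ≈⟨ *-cong (pow-*-inverse γδ≈1 j) (*-cong γδ≈1 (*-congʳ γδ≈1)) ⟩
    1# * (1# * (1# * Q))
      ≈⟨ trans (*-identityˡ _) (trans (*-identityˡ _) (*-identityˡ _)) ⟩
    Q
      ∎
    where
    open ≈-Reasoning
    P : ℤ[X]
    P = momentsᴾ μ (2 ℕ.+ j)
    Q : Carrier
    Q = evalPoly (drop 1 P) (γ * γ)
    P[0]≈0 : evalPoly P 0# ≈ 0#
    P[0]≈0 = trans (evalSeries-momentsᴾ 0# μ (2 ℕ.+ j)) (momentsα-0# μ pos (2 ℕ.+ j))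

lemma1 : (k : ℕ) → 2 ≤ k → (μ : List ℕ) → IsPartition μ →
    Σ (List ℤ) (λ Q → (Rg : CommutativeRing 0ℓ 0ℓ) →
      (γ δ : CommutativeRing.Carrier Rg) →
      CommutativeRing._≈_ Rg (CommutativeRing._*_ Rg γ δ) (CommutativeRing.1# Rg) →
      CommutativeRing._≈_ Rg
        (CommutativeRing._*_ Rg (RingDefs.pow Rg γ (k ∸ 2)) (RingDefs.moment Rg γ δ k μ))
        (RingDefs.evalPoly Rg Q (CommutativeRing._*_ Rg γ γ)))
lemma1 (suc (suc j)) (s≤s (s≤s z≤n)) μ (_ , pos) =
  drop 1 (momentsᴾ μ (2 ℕ.+ j)) , λ Rg γ δ γδ≈1 → moment-polynomial Rg γδ≈1 j μ pos
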